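{- Let $N = p^k m^2$ be an odd perfect number, where $p$ is a prime with $p \equiv k \equiv 1 \pmod 4$, $k$ a positive integer, $m$ a positive integer and $\gcd(p,m)=1$. Then $$\frac{57}{20} < \frac{\sigma(p^k)}{p^k} + \frac{\sigma(m^2)}{m^2} < 3.$$
   Context: $\sigma(n)$ denotes the sum of the positive divisors of $n$. An odd perfect number is an odd positive integer $N$ with $\sigma(N)=2N$. -}

module Defs where

open import Data.Nat using (ℕ; zero; suc; _<_; _*_)
open import Relation.Nullary using (¬_)
open import Relation.Binary.PropositionalEquality using (_≡_)
open import Data.List using (List; filter)
open import Data.Nat.ListAction using (sum)
open import Data.List.Base using (upTo)
open import Data.Nat.Divisibility using (_∣_; _∣?_)
open import Data.Integer using (+_)
open import Data.Rational using (ℚ; _/_; 0ℚ)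

divisors : ℕ → List ℕ
divisors n = filter (λ d → d ∣? n) (Data.List.map suc (upTo n))
  where import Data.List

σ : ℕ → ℕ
σ n = sum (divisors n)

-- the abundancy index σ(n)/n as a rational number (convention: value 0 at n = 0,
-- never used since all arguments in the statement are positive)
abundancy : ℕ → ℚ
abundancy zero    = 0ℚ
abundancy (suc n) = (+ σ (suc n)) / suc n

record OddPerfect (N : ℕ) : Set where
  field
    odd     : ¬ (2 ∣ N)
    pos     : 0 < N
    perfect : σ N ≡ 2 * N

{-# OPTIONS --safe #-}
module Submission where

-- Write x = σ(pᵏ)/pᵏ and y = σ(m²)/m². Since gcd(p, m) = 1, σ is multiplicative on
-- N = pᵏ m², so perfectness gives x y = 2, and the sum in question is x + 2/x.
-- Now 1 < x < p/(p-1) ≤ 5/4 because p ≡ 1 (mod 4) forces p ≥ 5, and x + 2/x is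
-- decreasing on (1, √2), where it takes the values 3 at x = 1 and 57/20 at x = 5/4.

open import Data.Nat.Primality using (Prime)

module SumTo where

  open import Data.Nat hiding (_/_)
  open import Data.Nat.Properties
  open import Data.Nat.Divisibility using (_∣_; ∣m+n∣m⇒∣n; m∣m*n; ∣⇒≤)
  open import Algebra.Properties.CommutativeSemigroup +-commutativeSemigroup using (interchange)
  open import Relation.Nullary using (¬_)
  open import Relation.Binary.PropositionalEquality
  open ≡-Reasoning

  sumTo : ℕ → (ℕ → ℕ) → ℕ
  sumTo zero    f = 0
  sumTo (suc n) f = sumTo n f + f (suc n)

  sumTo-cong : ∀ n {f g} → (∀ d → f d ≡ g d) → sumTo n f ≡ sumTo n g
  sumTo-cong zero    f≗g = refl
  sumTo-cong (suc n) f≗g = cong₂ _+_ (sumTo-cong n f≗g) (f≗g (suc n))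

  sumTo-distrib-+ : ∀ n f g → sumTo n (λ d → f d + g d) ≡ sumTo n f + sumTo n g
  sumTo-distrib-+ zero    f g = refl
  sumTo-distrib-+ (suc n) f g = begin
    sumTo n (λ d → f d + g d) + (f (suc n) + g (suc n))
      ≡⟨ cong (_+ (f (suc n) + g (suc n))) (sumTo-distrib-+ n f g) ⟩
    (sumTo n f + sumTo n g) + (f (suc n) + g (suc n))
      ≡⟨ interchange (sumTo n f) (sumTo n g) (f (suc n)) (g (suc n)) ⟩
    (sumTo n f + f (suc n)) + (sumTo n g + g (suc n)) ∎

  sumTo-distribˡ-* : ∀ c n f → sumTo n (λ d → c * f d) ≡ c * sumTo n f
  sumTo-distribˡ-* c zero    f = sym (*-zeroʳ c)
  sumTo-distribˡ-* c (suc n) f =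
    trans (cong (_+ c * f (suc n)) (sumTo-distribˡ-* c n f)) (sym (*-distribˡ-+ c (sumTo n f) (f (suc n))))

  sumTo-+ : ∀ f a b → sumTo (a + b) f ≡ sumTo a f + sumTo b (λ j → f (a + j))
  sumTo-+ f a zero    = trans (cong (λ n → sumTo n f) (+-identityʳ a)) (sym (+-identityʳ (sumTo a f)))
  sumTo-+ f a (suc b) = begin
    sumTo (a + suc b) f                                  ≡⟨ cong (λ n → sumTo n f) (+-suc a b) ⟩
    sumTo (a + b) f + f (suc (a + b))                    ≡⟨ cong₂ _+_ (sumTo-+ f a b) (cong f (sym (+-suc a b))) ⟩
    sumTo a f + sumTo b (λ j → f (a + j)) + f (a + suc b) ≡⟨ +-assoc (sumTo a f) _ _ ⟩
    sumTo a f + sumTo (suc b) (λ j → f (a + j))          ∎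

  sumTo-vanishing : ∀ f {n m} → n ≤ m → (∀ d → n < d → d ≤ m → f d ≡ 0) → sumTo m f ≡ sumTo n f
  sumTo-vanishing f n≤m = go (≤⇒≤′ n≤m)
    where
    go : ∀ {n m} → n ≤′ m → (∀ d → n < d → d ≤ m → f d ≡ 0) → sumTo m f ≡ sumTo n f
    go ≤′-refl                _      = refl
    go {n} (≤′-step {m} n≤′m) vanish = begin
      sumTo m f + f (suc m) ≡⟨ cong (sumTo m f +_) (vanish (suc m) (s≤s (≤′⇒≤ n≤′m)) ≤-refl) ⟩
      sumTo m f + 0         ≡⟨ +-identityʳ (sumTo m f) ⟩
      sumTo m f             ≡⟨ go n≤′m (λ d n<d d≤m → vanish d n<d (m≤n⇒m≤1+n d≤m)) ⟩
      sumTo n f             ∎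

  sumTo-multiples : ∀ p .{{_ : NonZero p}} f → (∀ d → ¬ p ∣ d → f d ≡ 0) →
                    ∀ n → sumTo (p * n) f ≡ sumTo n (λ e → f (p * e))
  sumTo-multiples p f vanish zero    = cong (λ n → sumTo n f) (*-zeroʳ p)
  sumTo-multiples p@(suc q) f vanish (suc n) = begin
    sumTo (p * suc n) f
      ≡⟨ cong (λ k → sumTo k f) (trans (*-suc p n) (+-comm p (p * n))) ⟩
    sumTo (p * n + p) f
      ≡⟨ sumTo-+ f (p * n) p ⟩
    sumTo (p * n) f + (sumTo q (λ j → f (p * n + j)) + f (p * n + p))
      ≡⟨ cong₂ (λ s t → s + (t + f (p * n + p))) (sumTo-multiples p f vanish n)
               (sumTo-vanishing _ z≤n (λ j 0<j j≤q → vanish _ (¬p∣pn+j j 0<j j≤q))) ⟩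
    sumTo n (λ e → f (p * e)) + f (p * n + p)
      ≡⟨ cong (λ k → sumTo n (λ e → f (p * e)) + f k) (trans (+-comm (p * n) p) (sym (*-suc p n))) ⟩
    sumTo (suc n) (λ e → f (p * e)) ∎
    where
    ¬p∣pn+j : ∀ j → 0 < j → j ≤ q → ¬ p ∣ p * n + j
    ¬p∣pn+j j 0<j j≤q p∣pn+j = <⇒≱ (s≤s j≤q) (∣⇒≤ {{>-nonZero 0<j}} (∣m+n∣m⇒∣n p∣pn+j (m∣m*n n)))

module DivisorSum where

  open import Data.Nat hiding (_/_)
  open import Data.Nat.Properties
  open import Data.Nat.Divisibility
  open import Data.Nat.ListAction using (sum)
  open import Data.Nat.ListAction.Properties using (sum-++)
  open import Data.List using ([]; _∷_; _++_; filter; map; upTo)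
  open import Data.List.Properties using (upTo-∷ʳ; filter-++; map-++; filter-accept; filter-reject)
  open import Relation.Nullary using (¬_; Dec; yes; no; contradiction)
  open import Relation.Binary.PropositionalEquality
  open ≡-Reasoning
  open import Defs using (σ)
  open SumTo

  ifDivides : ℕ → ℕ → ℕ
  ifDivides n d with d ∣? n
  ... | yes _ = d
  ... | no  _ = 0

  ifDivides-yes : ∀ {n d} → d ∣ n → ifDivides n d ≡ d
  ifDivides-yes {n} {d} d∣n with d ∣? n
  ... | yes _   = refl
  ... | no  d∤n = contradiction d∣n d∤n

  ifDivides-no : ∀ {n d} → ¬ d ∣ n → ifDivides n d ≡ 0
  ifDivides-no {n} {d} d∤n with d ∣? n
  ... | yes d∣n = contradiction d∣n d∤n
  ... | no  _   = refl

  ifDivides-> : ∀ {n d} → 0 < n → n < d → ifDivides n d ≡ 0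
  ifDivides-> 0<n n<d = ifDivides-no (λ d∣n → <⇒≱ n<d (∣⇒≤ {{>-nonZero 0<n}} d∣n))

  ifDivides-cong : ∀ {n n′ d} → (d ∣ n → d ∣ n′) → (d ∣ n′ → d ∣ n) → ifDivides n d ≡ ifDivides n′ d
  ifDivides-cong {n} {n′} {d} to from with d ∣? n
  ... | yes d∣n = sym (ifDivides-yes (to d∣n))
  ... | no  d∤n = sym (ifDivides-no (λ d∣n′ → d∤n (from d∣n′)))

  divisorSum-upTo : ∀ n m → sum (filter (_∣? n) (map suc (upTo m))) ≡ sumTo m (ifDivides n)
  divisorSum-upTo n zero    = refl
  divisorSum-upTo n (suc m) = begin
    sum (filter (_∣? n) (map suc (upTo (suc m))))
      ≡⟨ cong (λ ds → sum (filter (_∣? n) (map suc ds))) (sym (upTo-∷ʳ m)) ⟩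
    sum (filter (_∣? n) (map suc (upTo m ++ m ∷ [])))
      ≡⟨ cong (λ ds → sum (filter (_∣? n) ds)) (map-++ suc (upTo m) (m ∷ [])) ⟩
    sum (filter (_∣? n) (map suc (upTo m) ++ suc m ∷ []))
      ≡⟨ cong sum (filter-++ (_∣? n) (map suc (upTo m)) (suc m ∷ [])) ⟩
    sum (filter (_∣? n) (map suc (upTo m)) ++ filter (_∣? n) (suc m ∷ []))
      ≡⟨ sum-++ (filter (_∣? n) (map suc (upTo m))) _ ⟩
    sum (filter (_∣? n) (map suc (upTo m))) + sum (filter (_∣? n) (suc m ∷ []))
      ≡⟨ cong₂ _+_ (divisorSum-upTo n m) (last (suc m ∣? n)) ⟩
    sumTo m (ifDivides n) + ifDivides n (suc m) ∎
    where
    last : ∀ {d} → Dec (d ∣ n) → sum (filter (_∣? n) (d ∷ [])) ≡ ifDivides n d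
    last (yes d∣n) = trans (cong sum (filter-accept (_∣? n) d∣n)) (trans (+-identityʳ _) (sym (ifDivides-yes d∣n)))
    last (no  d∤n) = trans (cong sum (filter-reject (_∣? n) d∤n)) (sym (ifDivides-no d∤n))

  σ≡sumTo-ifDivides : ∀ n → σ n ≡ sumTo n (ifDivides n)
  σ≡sumTo-ifDivides n = divisorSum-upTo n n

module PrimePowerDivisorSum {p} (p-prime : Prime p) where

  open import Defs using (σ)
  open import Data.Nat hiding (_/_)
  open import Data.Nat.Properties
  open import Data.Nat.Divisibility
  open import Data.Nat.Primality using (Prime; prime⇒irreducible; prime⇒nonZero; ¬prime[1])
  open import Data.Nat.Tactic.RingSolver using (solve-∀)
  open import Data.Nat.Coprimality using (Coprime; coprime-divisor)
  open import Data.Sum using (inj₁; inj₂)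
  open import Data.Product using (_,_)
  open import Relation.Nullary using (¬_; yes; no; contradiction)
  open import Relation.Binary.PropositionalEquality
  open ≡-Reasoning
  open SumTo
  open DivisorSum

  private instance
    p≢0 : NonZero p
    p≢0 = prime⇒nonZero p-prime

  onMultiples : (ℕ → ℕ) → ℕ → ℕ
  onMultiples f d with p ∣? d
  ... | yes _ = f d
  ... | no  _ = 0

  offMultiples : (ℕ → ℕ) → ℕ → ℕ
  offMultiples f d with p ∣? d
  ... | yes _ = 0
  ... | no  _ = f d

  onMultiples+offMultiples : ∀ f d → f d ≡ onMultiples f d + offMultiples f d
  onMultiples+offMultiples f d with p ∣? d
  ... | yes _ = sym (+-identityʳ (f d))
  ... | no  _ = refl

  onMultiples-yes : ∀ f {d} → p ∣ d → onMultiples f d ≡ f d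
  onMultiples-yes f {d} p∣d with p ∣? d
  ... | yes _   = refl
  ... | no  p∤d = contradiction p∣d p∤d

  onMultiples-no : ∀ f d → ¬ p ∣ d → onMultiples f d ≡ 0
  onMultiples-no f d p∤d with p ∣? d
  ... | yes p∣d = contradiction p∣d p∤d
  ... | no  _   = refl

  offMultiples-cong : ∀ f g d → (¬ p ∣ d → f d ≡ g d) → offMultiples f d ≡ offMultiples g d
  offMultiples-cong f g d f≡g with p ∣? d
  ... | yes _   = refl
  ... | no  p∤d = f≡g p∤d

  offMultiples-zero : ∀ f d → f d ≡ 0 → offMultiples f d ≡ 0
  offMultiples-zero f d fd≡0 with p ∣? d
  ... | yes _ = refl
  ... | no  _ = fd≡0

  σ-coprime : ℕ → ℕ
  σ-coprime n = sumTo n (offMultiples (ifDivides n))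

  ¬∣⇒coprime : ∀ {d} → ¬ p ∣ d → Coprime d p
  ¬∣⇒coprime p∤d (c∣d , c∣p) with prime⇒irreducible p-prime c∣p
  ... | inj₁ c≡1 = c≡1
  ... | inj₂ c≡p = contradiction (subst (_∣ _) c≡p c∣d) p∤d

  coprime-divisor-p^k : ∀ {d n} k → ¬ p ∣ d → d ∣ p ^ k * n → d ∣ n
  coprime-divisor-p^k {d} {n} zero    _   d∣n = subst (d ∣_) (*-identityˡ n) d∣n
  coprime-divisor-p^k {d} {n} (suc k) p∤d d∣p^k+1n =
    coprime-divisor-p^k k p∤d (coprime-divisor (¬∣⇒coprime p∤d) (subst (d ∣_) (*-assoc p (p ^ k) n) d∣p^k+1n))

  p∤1 : ¬ p ∣ 1
  p∤1 p∣1 = ¬prime[1] (subst Prime (∣1⇒≡1 p∣1) p-prime)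

  coprime⇒¬∣^ : ∀ {m} → Coprime p m → ∀ n → ¬ p ∣ m ^ n
  coprime⇒¬∣^ p⊥m zero    = p∤1
  coprime⇒¬∣^ p⊥m (suc n) p∣mmⁿ = coprime⇒¬∣^ p⊥m n (coprime-divisor p⊥m p∣mmⁿ)

  ifDivides-p* : ∀ n e → ifDivides (p * n) (p * e) ≡ p * ifDivides n e
  ifDivides-p* n e with e ∣? n
  ... | yes e∣n = ifDivides-yes (*-monoʳ-∣ p e∣n)
  ... | no  e∤n = trans (ifDivides-no (λ pe∣pn → e∤n (*-cancelˡ-∣ p pe∣pn))) (sym (*-zeroʳ p))

  σ-p* : ∀ n → σ (p * n) ≡ p * σ n + σ-coprime (p * n)
  σ-p* n = begin
    σ (p * n)
      ≡⟨ σ≡sumTo-ifDivides (p * n) ⟩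
    sumTo (p * n) (ifDivides (p * n))
      ≡⟨ sumTo-cong (p * n) (onMultiples+offMultiples (ifDivides (p * n))) ⟩
    sumTo (p * n) (λ d → onMultiples (ifDivides (p * n)) d + offMultiples (ifDivides (p * n)) d)
      ≡⟨ sumTo-distrib-+ (p * n) _ _ ⟩
    sumTo (p * n) (onMultiples (ifDivides (p * n))) + σ-coprime (p * n)
      ≡⟨ cong (_+ σ-coprime (p * n)) (sumTo-multiples p _ (onMultiples-no _) n) ⟩
    sumTo n (λ e → onMultiples (ifDivides (p * n)) (p * e)) + σ-coprime (p * n)
      ≡⟨ cong (_+ σ-coprime (p * n)) (sumTo-cong n (λ e → trans (onMultiples-yes _ (m∣m*n e)) (ifDivides-p* n e))) ⟩
    sumTo n (λ e → p * ifDivides n e) + σ-coprime (p * n)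
      ≡⟨ cong (_+ σ-coprime (p * n)) (trans (sumTo-distribˡ-* p n _) (cong (p *_) (sym (σ≡sumTo-ifDivides n)))) ⟩
    p * σ n + σ-coprime (p * n) ∎

  σ-coprime-p^k* : ∀ k {n} → 0 < n → σ-coprime (p ^ k * n) ≡ σ-coprime n
  σ-coprime-p^k* k {n} 0<n = begin
    sumTo (p ^ k * n) (offMultiples (ifDivides (p ^ k * n)))
      ≡⟨ sumTo-cong (p ^ k * n) (λ d → offMultiples-cong _ _ d (λ p∤d →
           ifDivides-cong (coprime-divisor-p^k k p∤d) (∣n⇒∣m*n (p ^ k)))) ⟩
    sumTo (p ^ k * n) (offMultiples (ifDivides n))
      ≡⟨ sumTo-vanishing _ (m≤n*m n (p ^ k) {{m^n≢0 p k}}) (λ d n<d _ →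
           offMultiples-zero _ d (ifDivides-> 0<n n<d)) ⟩
    sumTo n (offMultiples (ifDivides n)) ∎

  σ-coprime≡σ : ∀ {m} → ¬ p ∣ m → σ-coprime m ≡ σ m
  σ-coprime≡σ {m} p∤m = trans (sumTo-cong m offMultiples-ifDivides) (sym (σ≡sumTo-ifDivides m))
    where
    offMultiples-ifDivides : ∀ d → offMultiples (ifDivides m) d ≡ ifDivides m d
    offMultiples-ifDivides d with p ∣? d
    ... | yes p∣d = sym (ifDivides-no (λ d∣m → p∤m (∣-trans p∣d d∣m)))
    ... | no  _   = refl

  σ-p^suc-k* : ∀ k {m} → 0 < m → ¬ p ∣ m → σ (p ^ suc k * m) ≡ p * σ (p ^ k * m) + σ m
  σ-p^suc-k* k {m} 0<m p∤m = begin
    σ (p ^ suc k * m)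
      ≡⟨ cong σ (*-assoc p (p ^ k) m) ⟩
    σ (p * (p ^ k * m))
      ≡⟨ σ-p* (p ^ k * m) ⟩
    p * σ (p ^ k * m) + σ-coprime (p * (p ^ k * m))
      ≡⟨ cong (λ n → p * σ (p ^ k * m) + σ-coprime n) (sym (*-assoc p (p ^ k) m)) ⟩
    p * σ (p ^ k * m) + σ-coprime (p ^ suc k * m)
      ≡⟨ cong (p * σ (p ^ k * m) +_) (trans (σ-coprime-p^k* (suc k) 0<m) (σ-coprime≡σ p∤m)) ⟩
    p * σ (p ^ k * m) + σ m ∎

  σ-p^suc : ∀ k → σ (p ^ suc k) ≡ p * σ (p ^ k) + 1
  σ-p^suc k = begin
    σ (p ^ suc k)           ≡⟨ cong σ (sym (*-identityʳ (p ^ suc k))) ⟩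
    σ (p ^ suc k * 1)       ≡⟨ σ-p^suc-k* k z<s p∤1 ⟩
    p * σ (p ^ k * 1) + 1   ≡⟨ cong (λ n → p * σ n + 1) (*-identityʳ (p ^ k)) ⟩
    p * σ (p ^ k) + 1       ∎

  σ-multiplicative-p^k : ∀ k {m} → 0 < m → ¬ p ∣ m → σ (p ^ k * m) ≡ σ (p ^ k) * σ m
  σ-multiplicative-p^k zero    {m} _   _   = trans (cong σ (*-identityˡ m)) (sym (*-identityˡ (σ m)))
  σ-multiplicative-p^k (suc k) {m} 0<m p∤m = begin
    σ (p ^ suc k * m)                  ≡⟨ σ-p^suc-k* k 0<m p∤m ⟩
    p * σ (p ^ k * m) + σ m            ≡⟨ cong (λ s → p * s + σ m) (σ-multiplicative-p^k k 0<m p∤m) ⟩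
    p * (σ (p ^ k) * σ m) + σ m        ≡⟨ distrib p (σ (p ^ k)) (σ m) ⟩
    (p * σ (p ^ k) + 1) * σ m          ≡⟨ cong (_* σ m) (sym (σ-p^suc k)) ⟩
    σ (p ^ suc k) * σ m                ∎
    where
    distrib : ∀ p s t → p * (s * t) + t ≡ (p * s + 1) * t
    distrib = solve-∀

module PrimePowerBounds {p} (p-prime : Prime p) where

  open import Defs using (σ)
  open import Data.Nat hiding (_/_)
  open import Data.Nat.Properties
  open import Data.Nat.Tactic.RingSolver using (solve-∀)
  open import Relation.Binary.PropositionalEquality using (_≡_; cong; sym; trans; subst)
  open ≤-Reasoning
  open import Data.Nat.DivMod using (_/_; _%_; m≡m%n+[m/n]*n)
  open import Data.Nat.Primality using (Prime; ¬prime[1])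
  open import Relation.Nullary using (contradiction)
  open PrimePowerDivisorSum p-prime using (σ-p^suc)

  p≡1mod4⇒5≤p : p % 4 ≡ 1 → 5 ≤ p
  p≡1mod4⇒5≤p p%4≡1 with p / 4 | m≡m%n+[m/n]*n p 4
  ... | zero  | p≡p%4 = contradiction (subst Prime (trans p≡p%4 (cong (_+ 0) p%4≡1)) p-prime) ¬prime[1]
  ... | suc q | p≡1+4q = subst (5 ≤_) (sym (trans p≡1+4q (cong (_+ suc q * 4) p%4≡1))) (m≤m+n 5 (q * 4))

  p^k≤σ[p^k] : ∀ k → p ^ k ≤ σ (p ^ k)
  p^k≤σ[p^k] zero    = ≤-refl
  p^k≤σ[p^k] (suc k) = begin
    p * p ^ k          ≤⟨ *-monoʳ-≤ p (p^k≤σ[p^k] k) ⟩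
    p * σ (p ^ k)      ≤⟨ m≤m+n _ 1 ⟩
    p * σ (p ^ k) + 1  ≡⟨ sym (σ-p^suc k) ⟩
    σ (p ^ suc k)      ∎

  p^k<σ[p^k] : ∀ k → 0 < k → p ^ k < σ (p ^ k)
  p^k<σ[p^k] (suc k) _ = begin-strict
    p * p ^ k          ≤⟨ *-monoʳ-≤ p (p^k≤σ[p^k] k) ⟩
    p * σ (p ^ k)      <⟨ m<m+n _ z<s ⟩
    p * σ (p ^ k) + 1  ≡⟨ sym (σ-p^suc k) ⟩
    σ (p ^ suc k)      ∎

  4σ[p^k]<5p^k : 5 ≤ p → ∀ k → 4 * σ (p ^ k) < 5 * p ^ k
  4σ[p^k]<5p^k 5≤p zero    = ≤-refl
  4σ[p^k]<5p^k 5≤p (suc k) = begin-strict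
    4 * σ (p ^ suc k)        ≡⟨ cong (4 *_) (σ-p^suc k) ⟩
    4 * (p * σ (p ^ k) + 1)  ≡⟨ expand p (σ (p ^ k)) ⟩
    p * (4 * σ (p ^ k)) + 4  <⟨ +-monoʳ-< (p * (4 * σ (p ^ k))) ≤-refl ⟩
    p * (4 * σ (p ^ k)) + 5  ≤⟨ +-monoʳ-≤ (p * (4 * σ (p ^ k))) 5≤p ⟩
    p * (4 * σ (p ^ k)) + p  ≡⟨ trans (+-comm _ p) (sym (*-suc p (4 * σ (p ^ k)))) ⟩
    p * suc (4 * σ (p ^ k))  ≤⟨ *-monoʳ-≤ p (4σ[p^k]<5p^k 5≤p k) ⟩
    p * (5 * p ^ k)          ≡⟨ x*[y*z]≡y*[x*z] p 5 (p ^ k) ⟩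
    5 * (p * p ^ k)          ∎
    where
    expand : ∀ p s → 4 * (p * s + 1) ≡ p * (4 * s) + 4
    expand = solve-∀
    x*[y*z]≡y*[x*z] : ∀ x y z → x * (y * z) ≡ y * (x * z)
    x*[y*z]≡y*[x*z] = solve-∀

module AbundancyInequality where

  open import Data.Nat hiding (_/_)
  open import Data.Nat.Properties
  open import Data.Nat.Tactic.RingSolver using (solve-∀)
  open import Data.Product using (_×_; _,_; ∃₂)
  open import Relation.Binary.PropositionalEquality
  open ≡-Reasoning

  *-cancelˡ-<-+ : ∀ a {x y} z → a * y ≡ a * x + z → 0 < z → x < y
  *-cancelˡ-<-+ a {x} {y} z ay≡ax+z 0<z = *-cancelˡ-< a x y (subst (a * x <_) (sym ay≡ax+z) (m<m+n (a * x) 0<z))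

  1<A/P<5/4⇒P≡4t+u×A≡5t+u : ∀ {P A} → P < A → 4 * A < 5 * P →
                             ∃₂ λ t u → 0 < t × 0 < u × P ≡ 4 * t + u × A ≡ 5 * t + u
  1<A/P<5/4⇒P≡4t+u×A≡5t+u {P} {A} P<A 4A<5P =
    A ∸ P , P ∸ 4 * (A ∸ P) , m<n⇒0<n∸m P<A , m<n⇒0<n∸m 4t<P , sym P≡4t+u , A≡5t+u
    where
    P+t≡A : P + (A ∸ P) ≡ A
    P+t≡A = m+[n∸m]≡n (<⇒≤ P<A)
    4t<P : 4 * (A ∸ P) < P
    4t<P = +-cancelˡ-< (4 * P) (4 * (A ∸ P)) P (subst₂ _<_
      (trans (cong (4 *_) (sym P+t≡A)) (*-distribˡ-+ 4 P (A ∸ P))) (+-comm P (4 * P)) 4A<5P)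
    P≡4t+u : 4 * (A ∸ P) + (P ∸ 4 * (A ∸ P)) ≡ P
    P≡4t+u = m+[n∸m]≡n (<⇒≤ 4t<P)
    A≡5t+u : A ≡ 5 * (A ∸ P) + (P ∸ 4 * (A ∸ P))
    A≡5t+u = begin
      A                                          ≡⟨ sym P+t≡A ⟩
      P + (A ∸ P)                                ≡⟨ cong (_+ (A ∸ P)) (sym P≡4t+u) ⟩
      4 * (A ∸ P) + (P ∸ 4 * (A ∸ P)) + (A ∸ P) ≡⟨ regroup (A ∸ P) (P ∸ 4 * (A ∸ P)) ⟩
      5 * (A ∸ P) + (P ∸ 4 * (A ∸ P))           ∎
      where
      regroup : ∀ t u → 4 * t + u + t ≡ 5 * t + u
      regroup = solve-∀

  -- With x = A/P: 20x² − 57x + 40 = (5 − 4x)(8 − 5x) and 3x − x² − 2 = (x − 1)(2 − x),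
  -- and under P = 4t + u, A = 5t + u the four factors become u, 7t + 3u, t and 3t + u.
  x+2/x-bounds : ∀ {P A M B} → 0 < M → P < A → 4 * A < 5 * P → A * B ≡ 2 * P * M →
                 57 * (P * M) < (A * M + B * P) * 20 × A * M + B * P < 3 * (P * M)
  x+2/x-bounds {M = M} {B} 0<M P<A 4A<5P AB≡2PM with 1<A/P<5/4⇒P≡4t+u×A≡5t+u P<A 4A<5P
  ... | t , u , 0<t , 0<u , refl , refl = lower , upper
    where
    lower : 57 * ((4 * t + u) * M) < ((5 * t + u) * M + B * (4 * t + u)) * 20
    lower = *-cancelˡ-<-+ (5 * t + u) (M * u * (7 * t + 3 * u)) (begin
      (5 * t + u) * (((5 * t + u) * M + B * (4 * t + u)) * 20)
        ≡⟨ expand t u M B ⟩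
      20 * (5 * t + u) * (5 * t + u) * M + 20 * (4 * t + u) * ((5 * t + u) * B)
        ≡⟨ cong (λ AB → 20 * (5 * t + u) * (5 * t + u) * M + 20 * (4 * t + u) * AB) AB≡2PM ⟩
      20 * (5 * t + u) * (5 * t + u) * M + 20 * (4 * t + u) * (2 * (4 * t + u) * M)
        ≡⟨ factor t u M ⟩
      (5 * t + u) * (57 * ((4 * t + u) * M)) + M * u * (7 * t + 3 * u) ∎)
      (*-mono-< (*-mono-< 0<M 0<u) (<-≤-trans 0<u (≤-trans (m≤n*m u 3) (m≤n+m (3 * u) (7 * t)))))
      where
      expand : ∀ t u M B → (5 * t + u) * (((5 * t + u) * M + B * (4 * t + u)) * 20)
                         ≡ 20 * (5 * t + u) * (5 * t + u) * M + 20 * (4 * t + u) * ((5 * t + u) * B)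
      expand = solve-∀
      factor : ∀ t u M → 20 * (5 * t + u) * (5 * t + u) * M + 20 * (4 * t + u) * (2 * (4 * t + u) * M)
                       ≡ (5 * t + u) * (57 * ((4 * t + u) * M)) + M * u * (7 * t + 3 * u)
      factor = solve-∀
    upper : (5 * t + u) * M + B * (4 * t + u) < 3 * ((4 * t + u) * M)
    upper = *-cancelˡ-<-+ (5 * t + u) (M * t * (3 * t + u)) (begin
      (5 * t + u) * (3 * ((4 * t + u) * M))
        ≡⟨ factor t u M ⟩
      (5 * t + u) * (5 * t + u) * M + (4 * t + u) * (2 * (4 * t + u) * M) + M * t * (3 * t + u)
        ≡⟨ cong (λ AB → (5 * t + u) * (5 * t + u) * M + (4 * t + u) * AB + M * t * (3 * t + u)) (sym AB≡2PM) ⟩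
      (5 * t + u) * (5 * t + u) * M + (4 * t + u) * ((5 * t + u) * B) + M * t * (3 * t + u)
        ≡⟨ collect t u M B ⟩
      (5 * t + u) * ((5 * t + u) * M + B * (4 * t + u)) + M * t * (3 * t + u) ∎)
      (*-mono-< (*-mono-< 0<M 0<t) (<-≤-trans 0<u (m≤n+m u (3 * t))))
      where
      factor : ∀ t u M → (5 * t + u) * (3 * ((4 * t + u) * M))
                       ≡ (5 * t + u) * (5 * t + u) * M + (4 * t + u) * (2 * (4 * t + u) * M) + M * t * (3 * t + u)
      factor = solve-∀
      collect : ∀ t u M B → (5 * t + u) * (5 * t + u) * M + (4 * t + u) * ((5 * t + u) * B) + M * t * (3 * t + u)
                          ≡ (5 * t + u) * ((5 * t + u) * M + B * (4 * t + u)) + M * t * (3 * t + u)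
      collect = solve-∀

module AbundancySum where

  open import Defs using (σ; abundancy)
  open import Data.Nat as ℕ using (ℕ; suc; z<s)
  open import Data.Nat.Properties using (*-identityʳ)
  open import Data.Integer as ℤ using (+_; +<+)
  open import Data.Integer.Properties using (pos-+; pos-*)
  open import Data.Rational using (_/_; _+_; toℚᵘ) renaming (_<_ to _<ℚ_)
  open import Data.Rational.Properties using (toℚᵘ-fromℚᵘ; toℚᵘ-homo-+; toℚᵘ-cancel-<)
  open import Data.Rational.Unnormalised as ℚᵘ using (mkℚᵘ; _≃_; *<*)
  open import Data.Rational.Unnormalised.Properties using (≃-sym; ≃-trans; +-cong; <-respˡ-≃; <-respʳ-≃)
  open import Data.Product using (_×_; _,_)
  open import Relation.Binary.PropositionalEquality

  toℚᵘ-/suc : ∀ a d → toℚᵘ ((+ a) / suc d) ≃ mkℚᵘ (+ a) d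
  toℚᵘ-/suc a d = toℚᵘ-fromℚᵘ (mkℚᵘ (+ a) d)

  toℚᵘ-/+/ : ∀ a x b y → toℚᵘ ((+ a) / suc x + (+ b) / suc y) ≃ mkℚᵘ (+ a) x ℚᵘ.+ mkℚᵘ (+ b) y
  toℚᵘ-/+/ a x b y = ≃-trans (toℚᵘ-homo-+ ((+ a) / suc x) ((+ b) / suc y)) (+-cong (toℚᵘ-/suc a x) (toℚᵘ-/suc b y))

  pos-*+* : ∀ a b c d → + (a ℕ.* b ℕ.+ c ℕ.* d) ≡ + a ℤ.* + b ℤ.+ + c ℤ.* + d
  pos-*+* a b c d = trans (pos-+ (a ℕ.* b) (c ℕ.* d)) (cong₂ ℤ._+_ (pos-* a b) (pos-* c d))

  pos-[*+*]* : ∀ a b c d e → + ((a ℕ.* b ℕ.+ c ℕ.* d) ℕ.* e) ≡ (+ a ℤ.* + b ℤ.+ + c ℤ.* + d) ℤ.* + e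
  pos-[*+*]* a b c d e = trans (pos-* (a ℕ.* b ℕ.+ c ℕ.* d) e) (cong (ℤ._* + e) (pos-*+* a b c d))

  /<+/ : ∀ c d a x b y → c ℕ.* (suc x ℕ.* suc y) ℕ.< (a ℕ.* suc y ℕ.+ b ℕ.* suc x) ℕ.* suc d →
         (+ c) / suc d <ℚ (+ a) / suc x + (+ b) / suc y
  /<+/ c d a x b y lt = toℚᵘ-cancel-<
    (<-respˡ-≃ (≃-sym (toℚᵘ-/suc c d)) (<-respʳ-≃ (≃-sym (toℚᵘ-/+/ a x b y))
      (*<* (subst₂ ℤ._<_ (pos-* c _) (pos-[*+*]* a (suc y) b (suc x) (suc d)) (+<+ lt)))))

  +/</ : ∀ c d a x b y → (a ℕ.* suc y ℕ.+ b ℕ.* suc x) ℕ.* suc d ℕ.< c ℕ.* (suc x ℕ.* suc y) →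
         (+ a) / suc x + (+ b) / suc y <ℚ (+ c) / suc d
  +/</ c d a x b y lt = toℚᵘ-cancel-<
    (<-respʳ-≃ (≃-sym (toℚᵘ-/suc c d)) (<-respˡ-≃ (≃-sym (toℚᵘ-/+/ a x b y))
      (*<* (subst₂ ℤ._<_ (pos-[*+*]* a (suc y) b (suc x) (suc d)) (pos-* c _) (+<+ lt)))))

  abundancy-+-bounds : ∀ x y → 0 ℕ.< x → 0 ℕ.< y →
    57 ℕ.* (x ℕ.* y) ℕ.< (σ x ℕ.* y ℕ.+ σ y ℕ.* x) ℕ.* 20 × σ x ℕ.* y ℕ.+ σ y ℕ.* x ℕ.< 3 ℕ.* (x ℕ.* y) →
    ((+ 57) / 20 <ℚ abundancy x + abundancy y) × (abundancy x + abundancy y <ℚ (+ 3) / 1)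
  abundancy-+-bounds (suc x) (suc y) _ _ (lower , upper) =
    /<+/ 57 19 (σ (suc x)) x (σ (suc y)) y lower ,
    +/</ 3 0 (σ (suc x)) x (σ (suc y)) y (subst (ℕ._< 3 ℕ.* (suc x ℕ.* suc y)) (sym (*-identityʳ _)) upper)

open import Defs
open import Data.Nat using (ℕ; _^_; _%_; _<_; _*_)
open import Data.Nat.Primality using (Prime)
open import Data.Nat.Coprimality using (Coprime)
open import Relation.Binary.PropositionalEquality using (_≡_)
open import Data.Product using (_×_)
open import Data.Integer using (+_)
open import Data.Rational using (ℚ; _/_; _+_) renaming (_<_ to _<ℚ_)
open import Data.Nat using (>-nonZero)
open import Data.Nat.Properties using (m^n>0; *-assoc)
open import Data.Nat.Primality using (prime⇒nonZero)
open import Relation.Binary.PropositionalEquality using (cong; sym; module ≡-Reasoning)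
open ≡-Reasoning
open AbundancyInequality using (x+2/x-bounds)
open AbundancySum using (abundancy-+-bounds)

lemma4p2p4 : (N p k m : ℕ) → OddPerfect N → N ≡ p ^ k * m ^ 2 → Prime p
    → p % 4 ≡ 1 → k % 4 ≡ 1 → 0 < k → 0 < m → Coprime p m
    → ((+ 57) / 20 <ℚ abundancy (p ^ k) + abundancy (m ^ 2))
    × (abundancy (p ^ k) + abundancy (m ^ 2) <ℚ (+ 3) / 1)
lemma4p2p4 N p k m N-perfect N≡p^km² p-prime p≡1mod4 _ 0<k 0<m p⊥m =
  abundancy-+-bounds (p ^ k) (m ^ 2) (m^n>0 p {{prime⇒nonZero p-prime}} k) 0<m²
    (x+2/x-bounds 0<m² (p^k<σ[p^k] k 0<k) (4σ[p^k]<5p^k (p≡1mod4⇒5≤p p≡1mod4) k) σ[p^k]σ[m²]≡2p^km²)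
  where
  open PrimePowerDivisorSum p-prime using (σ-multiplicative-p^k; coprime⇒¬∣^)
  open PrimePowerBounds p-prime using (p^k<σ[p^k]; 4σ[p^k]<5p^k; p≡1mod4⇒5≤p)
  0<m² : 0 < m ^ 2
  0<m² = m^n>0 m {{>-nonZero 0<m}} 2
  σ[p^k]σ[m²]≡2p^km² : σ (p ^ k) * σ (m ^ 2) ≡ 2 * p ^ k * m ^ 2
  σ[p^k]σ[m²]≡2p^km² = begin
    σ (p ^ k) * σ (m ^ 2)  ≡⟨ sym (σ-multiplicative-p^k k 0<m² (coprime⇒¬∣^ p⊥m 2)) ⟩
    σ (p ^ k * m ^ 2)      ≡⟨ cong σ (sym N≡p^km²) ⟩
    σ N                    ≡⟨ OddPerfect.perfect N-perfect ⟩
    2 * N                  ≡⟨ cong (2 *_) N≡p^km² ⟩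
    2 * (p ^ k * m ^ 2)    ≡⟨ sym (*-assoc 2 (p ^ k) (m ^ 2)) ⟩
    2 * p ^ k * m ^ 2      ∎
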